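{- Let $\mathfrak{A}=\langle W,R,V\rangle$ be an $R$-connected Kripke structure whose frame $\langle W,R\rangle$ is transitive and Euclidean. Then every lantern $l\in L_{\mathfrak{A}}$ illuminates $Q_{\mathfrak{A}}$, i.e. $\langle l,q\rangle\in R$ for every $q\in Q_{\mathfrak{A}}$.
   Context: A Kripke structure is $\mathfrak{A}=\langle W,R,V\rangle$ with $R\subseteq W\times W$ and $V$ a valuation of propositional variables. Euclidean: $\langle x,y\rangle,\langle x,z\rangle\in R$ imply $\langle y,z\rangle\in R$. $\mathfrak{A}$ is $R$-connected if the graph $\langle W,R\cup R^{ -1}\rangle$ is connected. A world $w$ is a lantern if there is no $w'$ with $\langle w',w\rangle\in R$; $L_{\mathfrak{A}}$ is the set of lanterns and $Q_{\mathfrak{A}}:=W\setminus L_{\mathfrak{A}}$. -}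

module Defs where

open import Level using (Level; _⊔_; suc)
open import Data.Nat using (ℕ)
open import Data.Product using (∃)
open import Data.Sum using (_⊎_)
open import Relation.Nullary using (¬_)
open import Relation.Binary.Construct.Closure.ReflexiveTransitive using (Star)

record Kripke (a ℓ v : Level) : Set (Level.suc (a ⊔ ℓ ⊔ v)) where
  field
    W : Set a
    R : W → W → Set ℓ
    V : ℕ → W → Set v

module _ {a ℓ v : Level} (𝔄 : Kripke a ℓ v) where
  open Kripke 𝔄

  Transitive : Set (a ⊔ ℓ)
  Transitive = ∀ {x y z} → R x y → R y z → R x z

  Euclidean : Set (a ⊔ ℓ)
  Euclidean = ∀ {x y z} → R x y → R x z → R y z

  Sym : W → W → Set ℓ
  Sym x y = R x y ⊎ R y x

  RConnected : Set (a ⊔ ℓ)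
  RConnected = ∀ x y → Star Sym x y

  Lantern : W → Set (a ⊔ ℓ)
  Lantern w = ¬ (∃ λ w' → R w' w)

  -- Q_𝔄 = W \ L_𝔄, i.e. the worlds having some R-predecessor
  -- (stated positively; classically identical to ¬ Lantern w)
  InQ : W → Set (a ⊔ ℓ)
  InQ w = ∃ λ w' → R w' w

-- In a transitive Euclidean frame, a world sees everything its neighbours
-- in R ∪ R⁻¹ see: forward along R by transitivity, backward by the
-- Euclidean law.  So along any path of a connected frame all worlds have
-- the same successors, and a world of Q is a successor of its predecessor,
-- hence of every world whatsoever.
module Submission where

open import Defs
open import Level using (Level)
open import Data.Product using (_,_)
open import Data.Sum using (inj₁; inj₂)
open import Relation.Binary.Construct.Closure.ReflexiveTransitive using (Star; ε; _◅_)

module _ {a ℓ v : Level} (𝔄 : Kripke a ℓ v)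
         (trans : Transitive 𝔄) (eucl : Euclidean 𝔄) where
  open Kripke 𝔄

  Star-Sym⇒successor-⊆ : ∀ {x y z} → Star (Sym 𝔄) x y → R y z → R x z
  Star-Sym⇒successor-⊆ ε                 Ryz = Ryz
  Star-Sym⇒successor-⊆ (inj₁ Rxw ◅ path) Ryz = trans Rxw (Star-Sym⇒successor-⊆ path Ryz)
  Star-Sym⇒successor-⊆ (inj₂ Rwx ◅ path) Ryz = eucl Rwx (Star-Sym⇒successor-⊆ path Ryz)

  RConnected⇒sees-InQ : RConnected 𝔄 → ∀ x q → InQ 𝔄 q → R x q
  RConnected⇒sees-InQ conn x q (p , Rpq) = Star-Sym⇒successor-⊆ (conn x p) Rpq

mainTheorem11 : {a ℓ v : Level} (𝔄 : Kripke a ℓ v) →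
    RConnected 𝔄 → Transitive 𝔄 → Euclidean 𝔄 →
    ∀ (l q : Kripke.W 𝔄) → Lantern 𝔄 l → InQ 𝔄 q → Kripke.R 𝔄 l q
mainTheorem11 𝔄 conn trans eucl l q _ = RConnected⇒sees-InQ 𝔄 trans eucl conn l q
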